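{- Let $\mathscr{U}=(U,\mathcal{A},\lambda)$ be a linear reflexive object in a Cartesian closed differential category. Let $S,T$ be differential $\lambda$-terms, $\vec x=x_1,\dots,x_n$ a sequence of distinct variables and $y$ a variable not occurring in $\vec x$, such that $\vec x,y$ is adequate for $S$ and $\vec x$ is adequate for $T$. Then $[\![S\{T/y\}]\!]_{\vec x}=[\![S]\!]_{\vec x,y}\circ\langle\mathrm{Id},[\![T]\!]_{\vec x}\rangle$.
   Context: Cartesian closed differential category: a category with commutative-monoid homsets $(+,0)$ satisfying $(g+h)\circ f=g\circ f+h\circ f$, $0\circ f=0$, with finite products whose projections are additive ($f\circ(g+h)=f\circ g+f\circ h$, $f\circ0=0$) and pairings of additive maps additive, with an operator $D$ sending $f:A\to B$ to $D(f):A\times A\to B$ satisfying (D1) $D(f+g)=D(f)+D(g)$, $D(0)=0$; (D2) $D(f)\circ\langle h+k,v\rangle=D(f)\circ\langle h,v\rangle+D(f)\circ\langle k,v\rangle$, $D(f)\circ\langle0,v\rangle=0$; (D3) $D(\mathrm{Id})=\pi_1$, $D(\pi_1)=\pi_1\circ\pi_1$, $D(\pi_2)=\pi_2\circ\pi_1$; (D4) $D\langle f,g\rangle=\langle D(f),D(g)\rangle$; (D5) $D(f\circ g)=D(f)\circ\langle D(g),g\circ\pi_2\rangle$; (D6) $D(D(f))\circ\langle\langle g,0\rangle,\langle h,k\rangle\rangle=D(f)\circ\langle g,k\rangle$; (D7) $D(D(f))\circ\langle\langle0,h\rangle,\langle g,k\rangle\rangle=D(D(f))\circ\langle\langle0,g\rangle,\langle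 h,k\rangle\rangle$; which is Cartesian closed (exponential $[A\Rightarrow B]$, $\mathrm{ev}$, currying $\Lambda$) with $\Lambda(f+g)=\Lambda(f)+\Lambda(g)$, $\Lambda(0)=0$ and $D(\Lambda(f))=\Lambda(D(f)\circ\langle\pi_1\times0_A,\pi_2\times\mathrm{Id}_A\rangle)$ for $f:C\times A\to B$. $\Lambda^-(h)=\mathrm{ev}\circ(h\times\mathrm{Id})$. $f$ is linear if $D(f)=f\circ\pi_1$. For $f:C\times A\to B$, $g:C\to A$: $f\star g=D(f)\circ\langle\langle0_C,g\circ\pi_1\rangle,\mathrm{Id}_{C\times A}\rangle$. A linear reflexive object is $(U,\mathcal{A},\lambda)$ with $\mathcal{A}:U\to[U\Rightarrow U]$, $\lambda:[U\Rightarrow U]\to U$, $\mathcal{A}\circ\lambda=\mathrm{Id}$, both linear. Differential $\lambda$-terms $S,T::=0\mid s\mid s+T$, simple terms $s,t::=x\mid\lambda x.s\mid sT\mid\mathsf{D}s\cdot t$, modulo $\alpha$-conversion, AC of $+$ with unit $0$, and permutation of the arguments of iterated linear application $\mathsf{D}^ns\cdot(t_1,\dots,t_n)$ (where $\mathsf{D}^1s\cdot t=\mathsf{D}s\cdot t$, $\mathsf{D}^{n+1}s\cdot(t,t_1,\dots,t_n)=\mathsf{D}^n(\mathsf{D}s\cdot t)\cdot(t_1,\dots,t_n)$); abbreviations $\lambda x.\sum s_i=\sum\lambda x.s_i$, $(\sum s_i)T=\sum s_iT$, $\mathsf{D}(\sum s_i)\cdot(\sum t_j)=\sum\mathsf{D}s_i\cdot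 t_j$. $S\{T/y\}$ is the usual capture-avoiding substitution of $T$ for all free occurrences of $y$, acting componentwise on all constructors, with $0\{T/y\}=0$. Interpretation: for distinct variables $\vec x=x_1,\dots,x_n$, $U^{\vec x}=U^{x_1..x_{n-1}}\times U$ (empty sequence: terminal object), $\pi^{\vec x}_n=\pi_2$, $\pi^{\vec x}_i=\pi^{x_1..x_{n-1}}_i\circ\pi_1$; $\vec x$ adequate for $S$ if it contains all free variables of $S$. $[\![x_i]\!]_{\vec x}=\pi_i^{\vec x}$; $[\![sT]\!]=\mathrm{ev}\circ\langle\mathcal{A}\circ[\![s]\!],[\![T]\!]\rangle$; $[\![\lambda z.s]\!]_{\vec x}=\lambda\circ\Lambda([\![s]\!]_{\vec x,z})$; $[\![\mathsf{D}^1s\cdot t]\!]=\lambda\circ\Lambda(\Lambda^-(\mathcal{A}\circ[\![s]\!])\star[\![t]\!])$; $[\![\mathsf{D}^{n+1}s\cdot(t_1..t_{n+1})]\!]=\lambda\circ\Lambda(\Lambda^-(\mathcal{A}\circ[\![\mathsf{D}^ns\cdot(t_1..t_n)]\!])\star[\![t_{n+1}]\!])$; $[\![0]\!]=0$; $[\![s+S]\!]=[\![s]\!]+[\![S]\!]$. -}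

module Defs where

open import Level using (Level; _⊔_) renaming (suc to lsuc)
open import Data.Nat using (ℕ; zero; suc)
open import Data.Fin using (Fin; zero; suc)
open import Data.List using (List; []; _∷_; map; concatMap; _++_)
open import Data.Product using () renaming (_×_ to _∧_)
open import Relation.Binary.PropositionalEquality using (_≡_)

record CCDC (o ℓ : Level) : Set (lsuc (o ⊔ ℓ)) where
  infixr 9 _∘_
  infixl 6 _+_
  infixr 7 _⊗_
  infixr 5 _⇒_
  field
    Obj : Set o
    Hom : Obj → Obj → Set ℓ
    id : ∀ {A} → Hom A A
    _∘_ : ∀ {A B C} → Hom B C → Hom A B → Hom A C
    assoc : ∀ {A B C E} (f : Hom C E) (g : Hom B C) (h : Hom A B) →
      (f ∘ g) ∘ h ≡ f ∘ (g ∘ h)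
    identityˡ : ∀ {A B} (f : Hom A B) → id ∘ f ≡ f
    identityʳ : ∀ {A B} (f : Hom A B) → f ∘ id ≡ f

    _+_ : ∀ {A B} → Hom A B → Hom A B → Hom A B
    0# : ∀ {A B} → Hom A B
    +-assoc : ∀ {A B} (f g h : Hom A B) → (f + g) + h ≡ f + (g + h)
    +-comm : ∀ {A B} (f g : Hom A B) → f + g ≡ g + f
    +-identityˡ : ∀ {A B} (f : Hom A B) → 0# + f ≡ f
    +-∘ : ∀ {A B C} (g h : Hom B C) (f : Hom A B) → (g + h) ∘ f ≡ g ∘ f + h ∘ f
    0-∘ : ∀ {A B C} (f : Hom A B) → 0# {B} {C} ∘ f ≡ 0#

    ⊤ : Obj
    ! : ∀ {A} → Hom A ⊤
    !-unique : ∀ {A} (f : Hom A ⊤) → f ≡ !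
    _⊗_ : Obj → Obj → Obj
    π₁ : ∀ {A B} → Hom (A ⊗ B) A
    π₂ : ∀ {A B} → Hom (A ⊗ B) B
    ⟨_,_⟩ : ∀ {A B C} → Hom C A → Hom C B → Hom C (A ⊗ B)
    π₁-β : ∀ {A B C} (f : Hom C A) (g : Hom C B) → π₁ ∘ ⟨ f , g ⟩ ≡ f
    π₂-β : ∀ {A B C} (f : Hom C A) (g : Hom C B) → π₂ ∘ ⟨ f , g ⟩ ≡ g
    ⟨⟩-unique : ∀ {A B C} (h : Hom C (A ⊗ B)) (f : Hom C A) (g : Hom C B) →
      π₁ ∘ h ≡ f → π₂ ∘ h ≡ g → h ≡ ⟨ f , g ⟩
    π₁-+ : ∀ {A B C} (f g : Hom C (A ⊗ B)) → π₁ ∘ (f + g) ≡ π₁ ∘ f + π₁ ∘ g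
    π₁-0 : ∀ {A B C} → π₁ ∘ 0# {C} {A ⊗ B} ≡ 0#
    π₂-+ : ∀ {A B C} (f g : Hom C (A ⊗ B)) → π₂ ∘ (f + g) ≡ π₂ ∘ f + π₂ ∘ g
    π₂-0 : ∀ {A B C} → π₂ ∘ 0# {C} {A ⊗ B} ≡ 0#
    ⟨⟩-additive : ∀ {A B C} (f : Hom A B) (g : Hom A C) →
      (∀ {X} (h k : Hom X A) → f ∘ (h + k) ≡ f ∘ h + f ∘ k) →
      (∀ {X} → f ∘ 0# {X} {A} ≡ 0#) →
      (∀ {X} (h k : Hom X A) → g ∘ (h + k) ≡ g ∘ h + g ∘ k) →
      (∀ {X} → g ∘ 0# {X} {A} ≡ 0#) →
      (∀ {X} (h k : Hom X A) → ⟨ f , g ⟩ ∘ (h + k) ≡ ⟨ f , g ⟩ ∘ h + ⟨ f , g ⟩ ∘ k)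
        ∧ (∀ {X} → ⟨ f , g ⟩ ∘ 0# {X} {A} ≡ 0#)

    D : ∀ {A B} → Hom A B → Hom (A ⊗ A) B
    D1-+ : ∀ {A B} (f g : Hom A B) → D (f + g) ≡ D f + D g
    D1-0 : ∀ {A B} → D (0# {A} {B}) ≡ 0#
    D2-+ : ∀ {A B C} (f : Hom A B) (h k v : Hom C A) →
      D f ∘ ⟨ h + k , v ⟩ ≡ D f ∘ ⟨ h , v ⟩ + D f ∘ ⟨ k , v ⟩
    D2-0 : ∀ {A B C} (f : Hom A B) (v : Hom C A) → D f ∘ ⟨ 0# , v ⟩ ≡ 0#
    D3-id : ∀ {A} → D (id {A}) ≡ π₁
    D3-π₁ : ∀ {A B} → D (π₁ {A} {B}) ≡ π₁ ∘ π₁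
    D3-π₂ : ∀ {A B} → D (π₂ {A} {B}) ≡ π₂ ∘ π₁
    D4 : ∀ {A B C} (f : Hom A B) (g : Hom A C) → D ⟨ f , g ⟩ ≡ ⟨ D f , D g ⟩
    D5 : ∀ {A B C} (f : Hom B C) (g : Hom A B) → D (f ∘ g) ≡ D f ∘ ⟨ D g , g ∘ π₂ ⟩
    D6 : ∀ {A B C} (f : Hom A B) (g h k : Hom C A) →
      D (D f) ∘ ⟨ ⟨ g , 0# ⟩ , ⟨ h , k ⟩ ⟩ ≡ D f ∘ ⟨ g , k ⟩
    D7 : ∀ {A B C} (f : Hom A B) (g h k : Hom C A) →
      D (D f) ∘ ⟨ ⟨ 0# , h ⟩ , ⟨ g , k ⟩ ⟩ ≡ D (D f) ∘ ⟨ ⟨ 0# , g ⟩ , ⟨ h , k ⟩ ⟩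

    -- Cartesian closed structure  (f ×ₘ g = ⟨ f ∘ π₁ , g ∘ π₂ ⟩)
    _⇒_ : Obj → Obj → Obj
    ev : ∀ {A B} → Hom ((A ⇒ B) ⊗ A) B
    Λ : ∀ {A B C} → Hom (C ⊗ A) B → Hom C (A ⇒ B)
    Λ-β : ∀ {A B C} (f : Hom (C ⊗ A) B) → ev ∘ ⟨ Λ f ∘ π₁ , id ∘ π₂ ⟩ ≡ f
    Λ-unique : ∀ {A B C} (f : Hom (C ⊗ A) B) (h : Hom C (A ⇒ B)) →
      ev ∘ ⟨ h ∘ π₁ , id ∘ π₂ ⟩ ≡ f → h ≡ Λ f
    Λ-+ : ∀ {A B C} (f g : Hom (C ⊗ A) B) → Λ (f + g) ≡ Λ f + Λ g
    Λ-0 : ∀ {A B C} → Λ (0# {C ⊗ A} {B}) ≡ 0#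
    -- D(Λ f) = Λ(D f ∘ ⟨ π₁ ×ₘ 0_A , π₂ ×ₘ Id_A ⟩)
    D-Λ : ∀ {A B C} (f : Hom (C ⊗ A) B) →
      D (Λ f) ≡ Λ (D f ∘ ⟨ ⟨ π₁ ∘ π₁ , 0# {A} {A} ∘ π₂ ⟩ , ⟨ π₂ ∘ π₁ , id {A} ∘ π₂ ⟩ ⟩)

record LinearReflexive {o ℓ} (𝒞 : CCDC o ℓ) : Set (o ⊔ ℓ) where
  open CCDC 𝒞
  field
    U : Obj
    𝒜 : Hom U (U ⇒ U)
    lam : Hom (U ⇒ U) U
    𝒜∘lam : 𝒜 ∘ lam ≡ id
    𝒜-linear : D 𝒜 ≡ 𝒜 ∘ π₁
    lam-linear : D lam ≡ lam ∘ π₁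

-- Differential λ-terms, well-scoped (de Bruijn; index zero = the most
-- recently bound / last variable of the context sequence).
-- A sum S = s₁ + … + sₖ is a list of simple terms; 0 is [].

data Simple (n : ℕ) : Set where
  var  : Fin n → Simple n
  ƛ    : Simple (suc n) → Simple n
  _·_  : Simple n → List (Simple n) → Simple n
  D[_]·_ : Simple n → Simple n → Simple n

Term : ℕ → Set
Term n = List (Simple n)

mutual
  ren : ∀ {n m} → (Fin n → Fin m) → Simple n → Simple m
  ren ρ (var i) = var (ρ i)
  ren ρ (ƛ s) = ƛ (ren (extʳ ρ) s)
  ren ρ (s · T) = ren ρ s · renT ρ T
  ren ρ (D[ s ]· t) = D[ ren ρ s ]· ren ρ t

  renT : ∀ {n m} → (Fin n → Fin m) → Term n → Term m
  renT ρ [] = []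
  renT ρ (s ∷ S) = ren ρ s ∷ renT ρ S

  extʳ : ∀ {n m} → (Fin n → Fin m) → Fin (suc n) → Fin (suc m)
  extʳ ρ zero = zero
  extʳ ρ (suc i) = suc (ρ i)

-- capture-avoiding simultaneous substitution (variables ↦ sums), with the
-- abbreviations  λx.Σsᵢ = Σ λx.sᵢ,  (Σsᵢ)T = Σ sᵢT,  D(Σsᵢ)·(Σtⱼ) = Σ D sᵢ·tⱼ
exts : ∀ {n m} → (Fin n → Term m) → Fin (suc n) → Term (suc m)
exts σ zero = var zero ∷ []
exts σ (suc i) = renT suc (σ i)

mutual
  sub : ∀ {n m} → (Fin n → Term m) → Simple n → Term m
  sub σ (var i) = σ i
  sub σ (ƛ s) = map ƛ (sub (exts σ) s)
  sub σ (s · T) = map (λ s′ → s′ · subT σ T) (sub σ s)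
  sub σ (D[ s ]· t) = concatMap (λ s′ → map (λ t′ → D[ s′ ]· t′) (sub σ t)) (sub σ s)

  subT : ∀ {n m} → (Fin n → Term m) → Term n → Term m
  subT σ [] = []
  subT σ (s ∷ S) = sub σ s ++ subT σ S

-- S{T/y}, where y is the last variable of the context  x⃗,y
single : ∀ {n} → Term n → Fin (suc n) → Term n
single T zero = T
single T (suc i) = var i ∷ []

_[_/y] : ∀ {n} → Term (suc n) → Term n → Term n
S [ T /y] = subT (single T) S

module Interp {o ℓ} (𝒞 : CCDC o ℓ) (R : LinearReflexive 𝒞) where
  open CCDC 𝒞
  open LinearReflexive R

  Ctx : ℕ → Obj
  Ctx zero = ⊤
  Ctx (suc n) = Ctx n ⊗ U

  -- π^{x⃗}_i  (Fin index zero is the last variable xₙ)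
  proj : ∀ {n} → Fin n → Hom (Ctx n) U
  proj zero = π₂
  proj (suc i) = proj i ∘ π₁

  Λ⁻ : ∀ {A B C} → Hom C (A ⇒ B) → Hom (C ⊗ A) B
  Λ⁻ h = ev ∘ ⟨ h ∘ π₁ , id ∘ π₂ ⟩

  _⋆_ : ∀ {A B C} → Hom (C ⊗ A) B → Hom C A → Hom (C ⊗ A) B
  f ⋆ g = D f ∘ ⟨ ⟨ 0# , g ∘ π₁ ⟩ , id ⟩

  mutual
    ⟦_⟧ : ∀ {n} → Simple n → Hom (Ctx n) U
    ⟦ var i ⟧ = proj i
    ⟦ ƛ s ⟧ = lam ∘ Λ ⟦ s ⟧
    ⟦ s · T ⟧ = ev ∘ ⟨ 𝒜 ∘ ⟦ s ⟧ , ⟦ T ⟧ₜ ⟩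
    ⟦ D[ s ]· t ⟧ = lam ∘ Λ (Λ⁻ (𝒜 ∘ ⟦ s ⟧) ⋆ ⟦ t ⟧)

    ⟦_⟧ₜ : ∀ {n} → Term n → Hom (Ctx n) U
    ⟦ [] ⟧ₜ = 0#
    ⟦ s ∷ S ⟧ₜ = ⟦ s ⟧ + ⟦ S ⟧ₜ

-- A substitution σ denotes the tuple ⟦ σ ⟧ₛ of the denotations of the terms it
-- substitutes, and ⟦ S{σ} ⟧ = ⟦ S ⟧ ∘ ⟦ σ ⟧ₛ by induction on S; the theorem is the
-- case σ = {T/y}, whose tuple is ⟨ id , ⟦ T ⟧ ⟩. Substitution distributes over
-- the sums it creates (λx.Σsᵢ = Σλx.sᵢ, ...), which is sound because every
-- term former is interpreted by a map that is additive in each argument: 𝒜 and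
-- λ are linear, Λ is additive by assumption and the operator ⋆ is additive in
-- both arguments by (D1) and (D2). Under a binder the substitution is extended
-- by the product with the identity, so one also needs naturality of each term
-- former in the context; for differential application this is the chain rule
-- (D5) applied to r × id, whose derivative in a direction (0, v) is (0, v).

module Submission where

open import Defs
open import Data.Nat using (ℕ; suc)
open import Data.Fin using (Fin; zero; suc)
open import Data.List using ([]; _∷_; map; concatMap; _++_)
open import Relation.Binary.PropositionalEquality
  using (_≡_; refl; sym; trans; cong; cong₂; module ≡-Reasoning)

module Properties {o ℓ} (𝒞 : CCDC o ℓ) where
  open CCDC 𝒞
  open ≡-Reasoning

  +-identityʳ : ∀ {A B} (f : Hom A B) → f + 0# ≡ f
  +-identityʳ f = trans (+-comm f 0#) (+-identityˡ f)

  record Additive {A B C E} (G : Hom A B → Hom C E) : Set ℓ where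
    field
      +-homo : ∀ f g → G (f + g) ≡ G f + G g
      0#-homo : G 0# ≡ 0#
  open Additive public

  ∘-additive : ∀ {A B C E X Y} {G : Hom C E → Hom X Y} {H : Hom A B → Hom C E} →
               Additive G → Additive H → Additive (λ f → G (H f))
  ∘-additive {G = G} {H} AG AH = record
    { +-homo = λ f g → trans (cong G (+-homo AH f g)) (+-homo AG (H f) (H g))
    ; 0#-homo = trans (cong G (0#-homo AH)) (0#-homo AG)
    }

  additive-ext : ∀ {A B C E} {G H : Hom A B → Hom C E} →
                 (∀ f → G f ≡ H f) → Additive G → Additive H
  additive-ext {G = G} {H} G≗H AG = record
    { +-homo = λ f g → trans (sym (G≗H (f + g))) (trans (+-homo AG f g) (cong₂ _+_ (G≗H f) (G≗H g)))
    ; 0#-homo = trans (sym (G≗H 0#)) (0#-homo AG)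
    }

  precomposition-additive : ∀ {A B C} (r : Hom A B) → Additive {B} {C} (_∘ r)
  precomposition-additive r = record { +-homo = λ g h → +-∘ g h r ; 0#-homo = 0-∘ r }

  ⟨⟩∘ : ∀ {A B C X} (f : Hom C A) (g : Hom C B) (h : Hom X C) →
        ⟨ f , g ⟩ ∘ h ≡ ⟨ f ∘ h , g ∘ h ⟩
  ⟨⟩∘ f g h = ⟨⟩-unique _ _ _
    (trans (sym (assoc _ _ _)) (cong (_∘ h) (π₁-β f g)))
    (trans (sym (assoc _ _ _)) (cong (_∘ h) (π₂-β f g)))

  ⟨⟩-η : ∀ {A B} → ⟨ π₁ , π₂ ⟩ ≡ id {A ⊗ B}
  ⟨⟩-η = sym (⟨⟩-unique id π₁ π₂ (identityʳ _) (identityʳ _))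

  ⟨⟩-+ : ∀ {A B C} (a c : Hom C A) (b d : Hom C B) →
         ⟨ a , b ⟩ + ⟨ c , d ⟩ ≡ ⟨ a + c , b + d ⟩
  ⟨⟩-+ a c b d = ⟨⟩-unique _ _ _
    (trans (π₁-+ _ _) (cong₂ _+_ (π₁-β a b) (π₁-β c d)))
    (trans (π₂-+ _ _) (cong₂ _+_ (π₂-β a b) (π₂-β c d)))

  ⟨⟩-0 : ∀ {A B C} → ⟨ 0# {C} {A} , 0# {C} {B} ⟩ ≡ 0#
  ⟨⟩-0 = sym (⟨⟩-unique 0# 0# 0# π₁-0 π₂-0)

  ∘π₁-β : ∀ {A B C X} (a : Hom A C) (x : Hom X A) (y : Hom X B) → (a ∘ π₁) ∘ ⟨ x , y ⟩ ≡ a ∘ x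
  ∘π₁-β a x y = trans (assoc _ _ _) (cong (a ∘_) (π₁-β x y))

  ∘π₂-β : ∀ {A B C X} (a : Hom B C) (x : Hom X A) (y : Hom X B) → (a ∘ π₂) ∘ ⟨ x , y ⟩ ≡ a ∘ y
  ∘π₂-β a x y = trans (assoc _ _ _) (cong (a ∘_) (π₂-β x y))

  _×id : ∀ {A B C} → Hom A B → Hom (A ⊗ C) (B ⊗ C)
  r ×id = ⟨ r ∘ π₁ , id ∘ π₂ ⟩

  ×id-∘ : ∀ {A B E C} (a : Hom B E) (b : Hom A B) →
          (_×id {C = C} a) ∘ (b ×id) ≡ (a ∘ b) ×id
  ×id-∘ a b = trans (⟨⟩∘ _ _ _) (cong₂ ⟨_,_⟩
    (trans (∘π₁-β a _ _) (sym (assoc _ _ _)))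
    (trans (∘π₂-β id _ _) (identityˡ _)))

  Linear : ∀ {A B} → Hom A B → Set ℓ
  Linear f = D f ≡ f ∘ π₁

  linear-D : ∀ {A B X} {f : Hom A B} → Linear f → (g v : Hom X A) → D f ∘ ⟨ g , v ⟩ ≡ f ∘ g
  linear-D {f = f} lin g v = trans (cong (_∘ ⟨ g , v ⟩) lin) (∘π₁-β f g v)

  -- f ∘ g = D f ∘ ⟨ g , 0 ⟩, which is additive in g by (D2).
  linear-additive : ∀ {A B X} {f : Hom A B} → Linear f → Additive {X} (f ∘_)
  linear-additive {f = f} lin = record
    { +-homo = λ g h → begin
        f ∘ (g + h)                         ≡⟨ sym (linear-D lin _ 0#) ⟩
        D f ∘ ⟨ g + h , 0# ⟩                ≡⟨ D2-+ f g h 0# ⟩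
        D f ∘ ⟨ g , 0# ⟩ + D f ∘ ⟨ h , 0# ⟩ ≡⟨ cong₂ _+_ (linear-D lin g 0#) (linear-D lin h 0#) ⟩
        f ∘ g + f ∘ h                       ∎
    ; 0#-homo = trans (sym (linear-D lin 0# 0#)) (D2-0 f 0#)
    }

  D-∘-linear : ∀ {A B C X} (f : Hom B C) {g : Hom A B} → Linear g → (u v : Hom X A) →
               D (f ∘ g) ∘ ⟨ u , v ⟩ ≡ D f ∘ ⟨ g ∘ u , g ∘ v ⟩
  D-∘-linear f {g} lin u v = begin
    D (f ∘ g) ∘ ⟨ u , v ⟩                    ≡⟨ cong (_∘ ⟨ u , v ⟩) (D5 f g) ⟩
    (D f ∘ ⟨ D g , g ∘ π₂ ⟩) ∘ ⟨ u , v ⟩      ≡⟨ assoc _ _ _ ⟩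
    D f ∘ (⟨ D g , g ∘ π₂ ⟩ ∘ ⟨ u , v ⟩)      ≡⟨ cong (D f ∘_) (⟨⟩∘ _ _ _) ⟩
    D f ∘ ⟨ D g ∘ ⟨ u , v ⟩ , (g ∘ π₂) ∘ ⟨ u , v ⟩ ⟩
      ≡⟨ cong (D f ∘_) (cong₂ ⟨_,_⟩ (linear-D lin u v) (∘π₂-β g u v)) ⟩
    D f ∘ ⟨ g ∘ u , g ∘ v ⟩                  ∎

  D-×id-vertical : ∀ {A B C X} (r : Hom A B) (v : Hom X C) (p : Hom X (A ⊗ C)) →
                   D (r ×id) ∘ ⟨ ⟨ 0# , v ⟩ , p ⟩ ≡ ⟨ 0# , v ⟩
  D-×id-vertical r v p = begin
    D (r ×id) ∘ P                             ≡⟨ cong (_∘ P) (D4 _ _) ⟩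
    ⟨ D (r ∘ π₁) , D (id ∘ π₂) ⟩ ∘ P          ≡⟨ ⟨⟩∘ _ _ _ ⟩
    ⟨ D (r ∘ π₁) ∘ P , D (id ∘ π₂) ∘ P ⟩
      ≡⟨ cong₂ ⟨_,_⟩ (D-∘-linear r D3-π₁ _ _) (D-∘-linear id D3-π₂ _ _) ⟩
    ⟨ D r ∘ ⟨ π₁ ∘ ⟨ 0# , v ⟩ , π₁ ∘ p ⟩ , D id ∘ ⟨ π₂ ∘ ⟨ 0# , v ⟩ , π₂ ∘ p ⟩ ⟩
      ≡⟨ cong₂ ⟨_,_⟩ horizontal vertical ⟩
    ⟨ 0# , v ⟩                                ∎
    where
    P = ⟨ ⟨ 0# , v ⟩ , p ⟩
    horizontal : D r ∘ ⟨ π₁ ∘ ⟨ 0# , v ⟩ , π₁ ∘ p ⟩ ≡ 0#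
    horizontal = trans (cong (λ z → D r ∘ ⟨ z , π₁ ∘ p ⟩) (π₁-β _ _)) (D2-0 r _)
    vertical : D id ∘ ⟨ π₂ ∘ ⟨ 0# , v ⟩ , π₂ ∘ p ⟩ ≡ v
    vertical = trans (cong (_∘ ⟨ π₂ ∘ ⟨ 0# , v ⟩ , π₂ ∘ p ⟩) D3-id)
                     (trans (π₁-β _ _) (π₂-β _ _))

  Λ-∘ : ∀ {A B C X} (f : Hom (C ⊗ A) B) (r : Hom X C) → Λ f ∘ r ≡ Λ (f ∘ (r ×id))
  Λ-∘ f r = Λ-unique _ _ (begin
    ev ∘ ((Λ f ∘ r) ×id)         ≡⟨ cong (ev ∘_) (sym (×id-∘ (Λ f) r)) ⟩
    ev ∘ ((Λ f ×id) ∘ (r ×id))   ≡⟨ sym (assoc _ _ _) ⟩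
    (ev ∘ (Λ f ×id)) ∘ (r ×id)   ≡⟨ cong (_∘ (r ×id)) (Λ-β f) ⟩
    f ∘ (r ×id)                  ∎)

  Λ-additive : ∀ {A B C} → Additive (Λ {A} {B} {C})
  Λ-additive = record { +-homo = Λ-+ ; 0#-homo = Λ-0 }

module Soundness {o ℓ} (𝒞 : CCDC o ℓ) (R : LinearReflexive 𝒞) where
  open CCDC 𝒞
  open LinearReflexive R
  open Interp 𝒞 R
  open Properties 𝒞
  open ≡-Reasoning

  Λ⁻-∘ : ∀ {A B C X} (h : Hom C (A ⇒ B)) (r : Hom X C) → Λ⁻ (h ∘ r) ≡ Λ⁻ h ∘ (r ×id)
  Λ⁻-∘ h r = trans (cong (ev ∘_) (sym (×id-∘ h r))) (sym (assoc _ _ _))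

  Λ-η : ∀ {A B C} (h : Hom C (A ⇒ B)) → h ≡ Λ (Λ⁻ h)
  Λ-η h = Λ-unique _ h refl

  Λ⁻-additive : ∀ {A B C} → Additive (Λ⁻ {A} {B} {C})
  Λ⁻-additive = record
    { +-homo = λ h k → begin
        Λ⁻ (h + k)                      ≡⟨ cong Λ⁻ (cong₂ _+_ (Λ-η h) (Λ-η k)) ⟩
        Λ⁻ (Λ (Λ⁻ h) + Λ (Λ⁻ k))        ≡⟨ cong Λ⁻ (sym (Λ-+ _ _)) ⟩
        Λ⁻ (Λ (Λ⁻ h + Λ⁻ k))            ≡⟨ Λ-β _ ⟩
        Λ⁻ h + Λ⁻ k                     ∎
    ; 0#-homo = trans (cong Λ⁻ (sym Λ-0)) (Λ-β _)
    }

  ev-⟨⟩ : ∀ {A B C} (h : Hom C (A ⇒ B)) (t : Hom C A) → Λ⁻ h ∘ ⟨ id , t ⟩ ≡ ev ∘ ⟨ h , t ⟩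
  ev-⟨⟩ h t = begin
    (ev ∘ (h ×id)) ∘ ⟨ id , t ⟩   ≡⟨ assoc _ _ _ ⟩
    ev ∘ ((h ×id) ∘ ⟨ id , t ⟩)   ≡⟨ cong (ev ∘_) (⟨⟩∘ _ _ _) ⟩
    ev ∘ ⟨ (h ∘ π₁) ∘ ⟨ id , t ⟩ , (id ∘ π₂) ∘ ⟨ id , t ⟩ ⟩
      ≡⟨ cong (ev ∘_) (cong₂ ⟨_,_⟩ (trans (∘π₁-β h id t) (identityʳ h))
                                   (trans (∘π₂-β id id t) (identityˡ t))) ⟩
    ev ∘ ⟨ h , t ⟩                ∎

  ev-additiveˡ : ∀ {A B C} (t : Hom C A) → Additive {B = A ⇒ B} (λ h → ev ∘ ⟨ h , t ⟩)
  ev-additiveˡ t = additive-ext (λ h → ev-⟨⟩ h t)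
    (∘-additive (precomposition-additive ⟨ id , t ⟩) Λ⁻-additive)

  ⋆-additiveˡ : ∀ {A B C} (g : Hom C A) → Additive {B = B} (_⋆ g)
  ⋆-additiveˡ g = ∘-additive (precomposition-additive _) (record { +-homo = D1-+ ; 0#-homo = D1-0 })

  ⋆-additiveʳ : ∀ {A B C} (F : Hom (C ⊗ A) B) → Additive (F ⋆_)
  ⋆-additiveʳ F = record
    { +-homo = λ g h → begin
        D F ∘ ⟨ ⟨ 0# , (g + h) ∘ π₁ ⟩ , id ⟩              ≡⟨ cong (λ z → D F ∘ ⟨ z , id ⟩) (split g h) ⟩
        D F ∘ ⟨ ⟨ 0# , g ∘ π₁ ⟩ + ⟨ 0# , h ∘ π₁ ⟩ , id ⟩  ≡⟨ D2-+ F _ _ id ⟩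
        F ⋆ g + F ⋆ h                                     ∎
    ; 0#-homo = trans (cong (λ z → D F ∘ ⟨ z , id ⟩) (trans (cong ⟨ 0# ,_⟩ (0-∘ π₁)) ⟨⟩-0))
                      (D2-0 F id)
    }
    where
    split : ∀ g h → ⟨ 0# , (g + h) ∘ π₁ ⟩ ≡ ⟨ 0# , g ∘ π₁ ⟩ + ⟨ 0# , h ∘ π₁ ⟩
    split g h = trans (cong₂ ⟨_,_⟩ (sym (+-identityˡ 0#)) (+-∘ g h π₁)) (sym (⟨⟩-+ _ _ _ _))

  ⋆-∘ : ∀ {A B C X} (F : Hom (C ⊗ A) B) (g : Hom C A) (r : Hom X C) →
        (F ⋆ g) ∘ (r ×id) ≡ (F ∘ (r ×id)) ⋆ (g ∘ r)
  ⋆-∘ F g r = begin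
    (D F ∘ ⟨ ⟨ 0# , g ∘ π₁ ⟩ , id ⟩) ∘ (r ×id)  ≡⟨ assoc _ _ _ ⟩
    D F ∘ (⟨ ⟨ 0# , g ∘ π₁ ⟩ , id ⟩ ∘ (r ×id))  ≡⟨ cong (D F ∘_) (trans transported (sym chain)) ⟩
    D F ∘ (⟨ D (r ×id) , (r ×id) ∘ π₂ ⟩ ∘ P)    ≡⟨ sym (assoc _ _ _) ⟩
    (D F ∘ ⟨ D (r ×id) , (r ×id) ∘ π₂ ⟩) ∘ P    ≡⟨ cong (_∘ P) (sym (D5 F (r ×id))) ⟩
    D (F ∘ (r ×id)) ∘ P                         ∎
    where
    P = ⟨ ⟨ 0# , (g ∘ r) ∘ π₁ ⟩ , id ⟩
    transported : ⟨ ⟨ 0# , g ∘ π₁ ⟩ , id ⟩ ∘ (r ×id) ≡ ⟨ ⟨ 0# , (g ∘ r) ∘ π₁ ⟩ , r ×id ⟩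
    transported = trans (⟨⟩∘ _ _ _) (cong₂ ⟨_,_⟩
      (trans (⟨⟩∘ _ _ _) (cong₂ ⟨_,_⟩ (0-∘ _) (trans (∘π₁-β g _ _) (sym (assoc _ _ _)))))
      (identityˡ _))
    chain : ⟨ D (r ×id) , (r ×id) ∘ π₂ ⟩ ∘ P ≡ ⟨ ⟨ 0# , (g ∘ r) ∘ π₁ ⟩ , r ×id ⟩
    chain = trans (⟨⟩∘ _ _ _)
      (cong₂ ⟨_,_⟩ (D-×id-vertical r _ id) (trans (∘π₂-β _ _ _) (identityʳ _)))

  App : ∀ {X} → Hom X U → Hom X U → Hom X U
  App f t = ev ∘ ⟨ 𝒜 ∘ f , t ⟩

  Lam : ∀ {X} → Hom (X ⊗ U) U → Hom X U
  Lam f = lam ∘ Λ f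

  Dap : ∀ {X} → Hom X U → Hom X U → Hom X U
  Dap f t = Lam (Λ⁻ (𝒜 ∘ f) ⋆ t)

  App-additiveˡ : ∀ {X} (t : Hom X U) → Additive (λ f → App f t)
  App-additiveˡ t = ∘-additive (ev-additiveˡ t) (linear-additive 𝒜-linear)

  Lam-additive : ∀ {X} → Additive (Lam {X})
  Lam-additive = ∘-additive (linear-additive lam-linear) Λ-additive

  Dap-additiveˡ : ∀ {X} (t : Hom X U) → Additive (λ f → Dap f t)
  Dap-additiveˡ t = ∘-additive Lam-additive
    (∘-additive (⋆-additiveˡ t) (∘-additive Λ⁻-additive (linear-additive 𝒜-linear)))

  Dap-additiveʳ : ∀ {X} (f : Hom X U) → Additive (Dap f)
  Dap-additiveʳ f = ∘-additive Lam-additive (⋆-additiveʳ _)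

  App-∘ : ∀ {X Y} (f t : Hom X U) (r : Hom Y X) → App f t ∘ r ≡ App (f ∘ r) (t ∘ r)
  App-∘ f t r = trans (assoc _ _ _) (cong (ev ∘_) (trans (⟨⟩∘ _ _ _)
    (cong ⟨_, t ∘ r ⟩ (assoc _ _ _))))

  Lam-∘ : ∀ {X Y} (f : Hom (X ⊗ U) U) (r : Hom Y X) → Lam f ∘ r ≡ Lam (f ∘ (r ×id))
  Lam-∘ f r = trans (assoc _ _ _) (cong (lam ∘_) (Λ-∘ f r))

  Dap-∘ : ∀ {X Y} (f t : Hom X U) (r : Hom Y X) → Dap f t ∘ r ≡ Dap (f ∘ r) (t ∘ r)
  Dap-∘ f t r = begin
    Lam (Λ⁻ (𝒜 ∘ f) ⋆ t) ∘ r                   ≡⟨ Lam-∘ _ r ⟩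
    Lam ((Λ⁻ (𝒜 ∘ f) ⋆ t) ∘ (r ×id))          ≡⟨ cong Lam (⋆-∘ _ t r) ⟩
    Lam ((Λ⁻ (𝒜 ∘ f) ∘ (r ×id)) ⋆ (t ∘ r))    ≡⟨ cong (λ z → Lam (z ⋆ (t ∘ r))) (sym (Λ⁻-∘ _ r)) ⟩
    Lam (Λ⁻ ((𝒜 ∘ f) ∘ r) ⋆ (t ∘ r))          ≡⟨ cong (λ z → Lam (Λ⁻ z ⋆ (t ∘ r))) (assoc _ _ _) ⟩
    Dap (f ∘ r) (t ∘ r)                        ∎

  ⟦++⟧ : ∀ {n} (S S′ : Term n) → ⟦ S ++ S′ ⟧ₜ ≡ ⟦ S ⟧ₜ + ⟦ S′ ⟧ₜ
  ⟦++⟧ [] S′ = sym (+-identityˡ _)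
  ⟦++⟧ (s ∷ S) S′ = trans (cong (⟦ s ⟧ +_) (⟦++⟧ S S′)) (sym (+-assoc _ _ _))

  ⟦map⟧ : ∀ {n m} {F : Simple n → Simple m} {G : Hom (Ctx n) U → Hom (Ctx m) U} →
          Additive G → (∀ s → ⟦ F s ⟧ ≡ G ⟦ s ⟧) → ∀ S → ⟦ map F S ⟧ₜ ≡ G ⟦ S ⟧ₜ
  ⟦map⟧ AG F≗G [] = sym (0#-homo AG)
  ⟦map⟧ AG F≗G (s ∷ S) = trans (cong₂ _+_ (F≗G s) (⟦map⟧ AG F≗G S)) (sym (+-homo AG _ _))

  ⟦concatMap-D⟧ : ∀ {n} (S T : Term n) →
                  ⟦ concatMap (λ s → map (D[ s ]·_) T) S ⟧ₜ ≡ Dap ⟦ S ⟧ₜ ⟦ T ⟧ₜ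
  ⟦concatMap-D⟧ [] T = sym (0#-homo (Dap-additiveˡ _))
  ⟦concatMap-D⟧ (s ∷ S) T = begin
    ⟦ map (D[ s ]·_) T ++ concatMap (λ s → map (D[ s ]·_) T) S ⟧ₜ
      ≡⟨ ⟦++⟧ (map (D[ s ]·_) T) _ ⟩
    ⟦ map (D[ s ]·_) T ⟧ₜ + ⟦ concatMap (λ s → map (D[ s ]·_) T) S ⟧ₜ
      ≡⟨ cong₂ _+_ (⟦map⟧ (Dap-additiveʳ ⟦ s ⟧) (λ _ → refl) T) (⟦concatMap-D⟧ S T) ⟩
    Dap ⟦ s ⟧ ⟦ T ⟧ₜ + Dap ⟦ S ⟧ₜ ⟦ T ⟧ₜ
      ≡⟨ sym (+-homo (Dap-additiveˡ _) _ _) ⟩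
    Dap ⟦ s ∷ S ⟧ₜ ⟦ T ⟧ₜ ∎

  tuple : ∀ {n X} → (Fin n → Hom X U) → Hom X (Ctx n)
  tuple {ℕ.zero} f = !
  tuple {suc n} f = ⟨ tuple (λ i → f (suc i)) , f zero ⟩

  tuple-cong : ∀ {n X} {f g : Fin n → Hom X U} → (∀ i → f i ≡ g i) → tuple f ≡ tuple g
  tuple-cong {ℕ.zero} f≗g = refl
  tuple-cong {suc n} f≗g = cong₂ ⟨_,_⟩ (tuple-cong (λ i → f≗g (suc i))) (f≗g zero)

  proj-tuple : ∀ {n X} (f : Fin n → Hom X U) (i : Fin n) → proj i ∘ tuple f ≡ f i
  proj-tuple f zero = π₂-β _ _
  proj-tuple f (suc i) = trans (∘π₁-β (proj i) _ _) (proj-tuple (λ j → f (suc j)) i)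

  tuple-∘ : ∀ {n X Y} (f : Fin n → Hom X U) (r : Hom Y X) →
            tuple f ∘ r ≡ tuple (λ i → f i ∘ r)
  tuple-∘ {ℕ.zero} f r = !-unique _
  tuple-∘ {suc n} f r = trans (⟨⟩∘ _ _ _) (cong ⟨_, f zero ∘ r ⟩ (tuple-∘ (λ i → f (suc i)) r))

  tuple-proj : ∀ {n} → tuple (proj {n}) ≡ id
  tuple-proj {ℕ.zero} = sym (!-unique id)
  tuple-proj {suc n} = begin
    ⟨ tuple (λ i → proj {n} i ∘ π₁) , π₂ ⟩  ≡⟨ cong ⟨_, π₂ ⟩ (sym (tuple-∘ (proj {n}) π₁)) ⟩
    ⟨ tuple (proj {n}) ∘ π₁ , π₂ ⟩          ≡⟨ cong (λ z → ⟨ z ∘ π₁ , π₂ ⟩) (tuple-proj {n}) ⟩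
    ⟨ id ∘ π₁ , π₂ ⟩                        ≡⟨ cong ⟨_, π₂ ⟩ (identityˡ π₁) ⟩
    ⟨ π₁ , π₂ ⟩                             ≡⟨ ⟨⟩-η ⟩
    id                                      ∎

  ⟦_⟧ᵣ : ∀ {n m} → (Fin n → Fin m) → Hom (Ctx m) (Ctx n)
  ⟦ ρ ⟧ᵣ = tuple (λ i → proj (ρ i))

  ⟦suc⟧ᵣ : ∀ {n} → ⟦ suc {n} ⟧ᵣ ≡ π₁
  ⟦suc⟧ᵣ {n} = trans (sym (tuple-∘ (proj {n}) π₁)) (trans (cong (_∘ π₁) (tuple-proj {n})) (identityˡ π₁))

  ⟦extʳ⟧ᵣ : ∀ {n m} (ρ : Fin n → Fin m) → ⟦ extʳ ρ ⟧ᵣ ≡ ⟦ ρ ⟧ᵣ ×id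
  ⟦extʳ⟧ᵣ ρ = cong₂ ⟨_,_⟩ (sym (tuple-∘ (λ i → proj (ρ i)) π₁)) (sym (identityˡ π₂))

  mutual
    ⟦ren⟧ : ∀ {n m} (ρ : Fin n → Fin m) (s : Simple n) → ⟦ ren ρ s ⟧ ≡ ⟦ s ⟧ ∘ ⟦ ρ ⟧ᵣ
    ⟦ren⟧ ρ (var i) = sym (proj-tuple _ i)
    ⟦ren⟧ ρ (ƛ s) = trans (cong Lam (trans (⟦ren⟧ (extʳ ρ) s) (cong (⟦ s ⟧ ∘_) (⟦extʳ⟧ᵣ ρ))))
                          (sym (Lam-∘ _ _))
    ⟦ren⟧ ρ (s · T) = trans (cong₂ App (⟦ren⟧ ρ s) (⟦renT⟧ ρ T)) (sym (App-∘ _ _ _))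
    ⟦ren⟧ ρ (D[ s ]· t) = trans (cong₂ Dap (⟦ren⟧ ρ s) (⟦ren⟧ ρ t)) (sym (Dap-∘ _ _ _))

    ⟦renT⟧ : ∀ {n m} (ρ : Fin n → Fin m) (S : Term n) → ⟦ renT ρ S ⟧ₜ ≡ ⟦ S ⟧ₜ ∘ ⟦ ρ ⟧ᵣ
    ⟦renT⟧ ρ [] = sym (0-∘ _)
    ⟦renT⟧ ρ (s ∷ S) = trans (cong₂ _+_ (⟦ren⟧ ρ s) (⟦renT⟧ ρ S)) (sym (+-∘ _ _ _))

  ⟦_⟧ₛ : ∀ {n m} → (Fin n → Term m) → Hom (Ctx m) (Ctx n)
  ⟦ σ ⟧ₛ = tuple (λ i → ⟦ σ i ⟧ₜ)

  ⟦exts⟧ₛ : ∀ {n m} (σ : Fin n → Term m) → ⟦ exts σ ⟧ₛ ≡ ⟦ σ ⟧ₛ ×id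
  ⟦exts⟧ₛ {m = m} σ = cong₂ ⟨_,_⟩ weakened (trans (+-identityʳ π₂) (sym (identityˡ π₂)))
    where
    weakened : tuple (λ i → ⟦ renT suc (σ i) ⟧ₜ) ≡ ⟦ σ ⟧ₛ ∘ π₁
    weakened = trans (tuple-cong (λ i → trans (⟦renT⟧ suc (σ i)) (cong (⟦ σ i ⟧ₜ ∘_) (⟦suc⟧ᵣ {m}))))
                     (sym (tuple-∘ (λ i → ⟦ σ i ⟧ₜ) π₁))

  mutual
    ⟦sub⟧ : ∀ {n m} (σ : Fin n → Term m) (s : Simple n) → ⟦ sub σ s ⟧ₜ ≡ ⟦ s ⟧ ∘ ⟦ σ ⟧ₛ
    ⟦sub⟧ σ (var i) = sym (proj-tuple _ i)
    ⟦sub⟧ σ (ƛ s) = begin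
      ⟦ map ƛ (sub (exts σ) s) ⟧ₜ      ≡⟨ ⟦map⟧ Lam-additive (λ _ → refl) (sub (exts σ) s) ⟩
      Lam ⟦ sub (exts σ) s ⟧ₜ          ≡⟨ cong Lam (⟦sub⟧ (exts σ) s) ⟩
      Lam (⟦ s ⟧ ∘ ⟦ exts σ ⟧ₛ)        ≡⟨ cong (λ z → Lam (⟦ s ⟧ ∘ z)) (⟦exts⟧ₛ σ) ⟩
      Lam (⟦ s ⟧ ∘ (⟦ σ ⟧ₛ ×id))       ≡⟨ sym (Lam-∘ _ _) ⟩
      Lam ⟦ s ⟧ ∘ ⟦ σ ⟧ₛ               ∎
    ⟦sub⟧ σ (s · T) = begin
      ⟦ map (_· subT σ T) (sub σ s) ⟧ₜ  ≡⟨ ⟦map⟧ (App-additiveˡ _) (λ _ → refl) (sub σ s) ⟩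
      App ⟦ sub σ s ⟧ₜ ⟦ subT σ T ⟧ₜ    ≡⟨ cong₂ App (⟦sub⟧ σ s) (⟦subT⟧ σ T) ⟩
      App (⟦ s ⟧ ∘ ⟦ σ ⟧ₛ) (⟦ T ⟧ₜ ∘ ⟦ σ ⟧ₛ) ≡⟨ sym (App-∘ _ _ _) ⟩
      App ⟦ s ⟧ ⟦ T ⟧ₜ ∘ ⟦ σ ⟧ₛ         ∎
    ⟦sub⟧ σ (D[ s ]· t) = begin
      ⟦ concatMap (λ s′ → map (D[ s′ ]·_) (sub σ t)) (sub σ s) ⟧ₜ
        ≡⟨ ⟦concatMap-D⟧ (sub σ s) (sub σ t) ⟩
      Dap ⟦ sub σ s ⟧ₜ ⟦ sub σ t ⟧ₜ     ≡⟨ cong₂ Dap (⟦sub⟧ σ s) (⟦sub⟧ σ t) ⟩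
      Dap (⟦ s ⟧ ∘ ⟦ σ ⟧ₛ) (⟦ t ⟧ ∘ ⟦ σ ⟧ₛ) ≡⟨ sym (Dap-∘ _ _ _) ⟩
      Dap ⟦ s ⟧ ⟦ t ⟧ ∘ ⟦ σ ⟧ₛ          ∎

    ⟦subT⟧ : ∀ {n m} (σ : Fin n → Term m) (S : Term n) → ⟦ subT σ S ⟧ₜ ≡ ⟦ S ⟧ₜ ∘ ⟦ σ ⟧ₛ
    ⟦subT⟧ σ [] = sym (0-∘ _)
    ⟦subT⟧ σ (s ∷ S) = trans (⟦++⟧ (sub σ s) (subT σ S))
      (trans (cong₂ _+_ (⟦sub⟧ σ s) (⟦subT⟧ σ S)) (sym (+-∘ _ _ _)))

  ⟦single⟧ₛ : ∀ {n} (T : Term n) → ⟦ single T ⟧ₛ ≡ ⟨ id , ⟦ T ⟧ₜ ⟩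
  ⟦single⟧ₛ {n} T = cong ⟨_, ⟦ T ⟧ₜ ⟩ (trans (tuple-cong {n} (λ i → +-identityʳ (proj i))) (tuple-proj {n}))

theorem4p9 : ∀ {o ℓ} (𝒞 : CCDC o ℓ) (R : LinearReflexive 𝒞) {n : ℕ}
               (S : Term (suc n)) (T : Term n) →
               let open CCDC 𝒞
                   open Interp 𝒞 R
               in ⟦ S [ T /y] ⟧ₜ ≡ ⟦ S ⟧ₜ ∘ ⟨ id , ⟦ T ⟧ₜ ⟩
theorem4p9 𝒞 R S T = begin
  ⟦ S [ T /y] ⟧ₜ            ≡⟨ ⟦subT⟧ (single T) S ⟩
  ⟦ S ⟧ₜ ∘ ⟦ single T ⟧ₛ    ≡⟨ cong (⟦ S ⟧ₜ ∘_) (⟦single⟧ₛ T) ⟩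
  ⟦ S ⟧ₜ ∘ ⟨ id , ⟦ T ⟧ₜ ⟩  ∎
  where
  open CCDC 𝒞
  open Interp 𝒞 R
  open Soundness 𝒞 R
  open ≡-Reasoning
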